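{- Let $G$ be a dominating graph with $n$ vertices, $m$ edges and minimum degree $\delta$. Then $$\mathrm{Var}(G)=\frac{M_1(G)}{n}-\Big(\frac{2m}{n}\Big)^2\le \Big(\frac{2m}{n}\Big)\frac{2m+(n-1)(n-1-\delta)}{2n-1-\delta}-\Big(\frac{2m}{n}\Big)^2,$$ and equality holds if $G$ is isomorphic to a complete split graph $CS(n,k)$, where $\delta=k$ and $m=[(2n-1)\delta-\delta^2]/2$.
   Context: A dominating graph is a connected graph that is irregular (has at least two distinct vertex degrees) and has at least one universal vertex (a vertex of degree $n-1$). $M_1(G)=\sum_i d_i^2$ is the first Zagreb index and $\mathrm{Var}(G)=\frac1n\sum_i(d_i-\frac{2m}{n})^2$. The complete split graph $CS(n,k)$ consists of a clique on $k$ vertices and an independent set of $n-k$ vertices, with every clique vertex adjacent to every vertex of the independent set. -}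

module Defs where

open import Data.Nat as ℕ using (ℕ; zero; suc; _∸_)
open import Data.Nat.Properties as ℕP using ()
open import Data.Bool using (Bool; true; false; not; _∧_; _∨_; if_then_else_)
open import Data.Bool.Properties using (∨-comm)
open import Data.Fin using (Fin; toℕ; _≟_)

open import Data.Fin.Permutation using (Permutation′; _⟨$⟩ʳ_)
open import Data.List using (List; map; foldr; allFin)
open import Data.Nat.ListAction using (sum)
open import Data.Integer using (+_)
open import Data.Rational using (ℚ; 0ℚ; _/_; _+_; _*_)
open import Data.Product using (Σ; ∃; ∃₂; _×_; _,_)
open import Relation.Nullary using (¬_; yes; no)
open import Relation.Nullary.Decidable using (⌊_⌋)
open import Relation.Binary.PropositionalEquality using (_≡_; _≢_; refl; sym; cong₂)

record Graph (n : ℕ) : Set where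
  field
    adj    : Fin n → Fin n → Bool
    adj-sym    : ∀ i j → adj i j ≡ adj j i
    adj-irrefl : ∀ i → adj i i ≡ false
open Graph public

𝟙 : Bool → ℕ
𝟙 true  = 1
𝟙 false = 0

degree : ∀ {n} → Graph n → Fin n → ℕ
degree {n} G i = sum (map (λ j → 𝟙 (adj G i j)) (allFin n))

edges : ∀ {n} → Graph n → ℕ
edges {n} G =
  sum (map (λ i → sum (map (λ j → 𝟙 (⌊ toℕ i ℕ.<? toℕ j ⌋ ∧ adj G i j)) (allFin n))) (allFin n))

M₁ : ∀ {n} → Graph n → ℕ
M₁ {n} G = sum (map (λ i → degree G i ℕ.* degree G i) (allFin n))

data Reachable {n} (G : Graph n) : Fin n → Fin n → Set where
  here : ∀ {u} → Reachable G u u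
  step : ∀ {u w v} → adj G u w ≡ true → Reachable G w v → Reachable G u v

Connected : ∀ {n} → Graph n → Set
Connected G = ∀ u v → Reachable G u v

Irregular : ∀ {n} → Graph n → Set
Irregular G = ∃₂ λ i j → degree G i ≢ degree G j

IsUniversal : ∀ {n} → Graph n → Fin n → Set
IsUniversal {n} G v = degree G v ≡ n ∸ 1

Dominating : ∀ {n} → Graph n → Set
Dominating G = Connected G × Irregular G × ∃ (IsUniversal G)

IsMinDegree : ∀ {n} → Graph n → ℕ → Set
IsMinDegree G δ = (∃ λ i → degree G i ≡ δ) × (∀ i → δ ℕ.≤ degree G i)

_≅_ : ∀ {n} → Graph n → Graph n → Set
_≅_ {n} G H = Σ (Permutation′ n) λ σ → ∀ i j → adj G i j ≡ adj H (σ ⟨$⟩ʳ i) (σ ⟨$⟩ʳ j)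

-- complete split graph CS(n,k): vertices with index < k form the clique,
-- the remaining n - k vertices are independent; clique vertices are adjacent to all others.
private
  neq : ∀ {n} → Fin n → Fin n → Bool
  neq i j = not ⌊ i ≟ j ⌋

  neq-sym : ∀ {n} (i j : Fin n) → neq i j ≡ neq j i
  neq-sym i j with i ≟ j | j ≟ i
  ... | yes _ | yes _ = refl
  ... | no _  | no _  = refl
  ... | yes p | no q  = Data.Empty.⊥-elim (q (sym p)) where import Data.Empty
  ... | no p  | yes q = Data.Empty.⊥-elim (p (sym q)) where import Data.Empty

  neq-irr : ∀ {n} (i : Fin n) → neq i i ≡ false
  neq-irr i with i ≟ i
  ... | yes _ = refl
  ... | no p  = Data.Empty.⊥-elim (p refl) where import Data.Empty

CS : (n k : ℕ) → Graph n
CS n k = record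
  { adj = λ i j → neq i j ∧ (⌊ toℕ i ℕ.<? k ⌋ ∨ ⌊ toℕ j ℕ.<? k ⌋)
  ; adj-sym = λ i j → cong₂ _∧_ (neq-sym i j) (∨-comm ⌊ toℕ i ℕ.<? k ⌋ ⌊ toℕ j ℕ.<? k ⌋)
  ; adj-irrefl = λ i → cong₂ _∧_ (neq-irr i) refl
  }

⟦_⟧ : ℕ → ℚ
⟦ a ⟧ = (+ a) / 1

-- division of a rational by a natural number (x ÷ₙ 0 := 0, never used with 0 here)
_÷ₙ_ : ℚ → ℕ → ℚ
x ÷ₙ zero  = 0ℚ
x ÷ₙ suc k = x * ((+ 1) / suc k)

sumℚ : List ℚ → ℚ
sumℚ = foldr _+_ 0ℚ

avgDeg : ∀ {n} → Graph n → ℚ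
avgDeg {n} G = ⟦ 2 ℕ.* edges G ⟧ ÷ₙ n

Var : ∀ {n} → Graph n → ℚ
Var {n} G = sumℚ (map (λ i → (⟦ degree G i ⟧ Data.Rational.- avgDeg G) * (⟦ degree G i ⟧ Data.Rational.- avgDeg G)) (allFin n)) ÷ₙ n

{-# OPTIONS --safe #-}
-- Write S = 2m = Σ dᵢ and D = n − 1. A vertex i is a non-neighbour of itself and each of its other
-- D − dᵢ non-neighbours has degree at least δ, so the degrees of the neighbours of i sum to at most
-- S − dᵢ − (D − dᵢ)δ. Weighting by dᵢ and summing gives P + M₁ + DδS ≤ S² + δM₁, where P = Σ dᵢdⱼ over
-- ordered adjacent pairs. Summing (D − dᵢ)(D − dⱼ) ≥ 0 over the same pairs gives 2DM₁ ≤ D²S + P.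
-- Eliminating P leaves (2D + 1 − δ)M₁ ≤ S(S + D(D − δ)), which is the bound once Var = M₁/n − (S/n)².
-- In CS(n,k) the k clique vertices have degree D and the others degree k, and both sides are computed.
module Submission where

open import Defs
open import Data.Nat using (ℕ; zero; suc)
open import Data.Fin as Fin using (Fin; toℕ)
import Data.List as List
import Data.List.Properties as List
import Data.Vec.Functional as Vector
open import Function using (_∘_; id)
open import Relation.Binary.PropositionalEquality

foldr-map-allFin : ∀ {a b} {A : Set a} {B : Set b} (_∙_ : A → B → B) (e : B) {n} (f : Fin n → A) →
                   List.foldr _∙_ e (List.map f (List.allFin n)) ≡ Vector.foldr _∙_ e f
foldr-map-allFin {A = A} _∙_ e f = trans (cong (List.foldr _∙_ e) (List.map-tabulate id f)) (foldr-tabulate f)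
  where
  foldr-tabulate : ∀ {n} (f : Fin n → A) → List.foldr _∙_ e (List.tabulate f) ≡ Vector.foldr _∙_ e f
  foldr-tabulate {zero}  f = refl
  foldr-tabulate {suc n} f = cong (f Fin.zero ∙_) (foldr-tabulate (f ∘ Fin.suc))

module Combinatorics where

  open import Data.Nat using (_+_; _*_; _∸_; _≤_; _<_; _<ᵇ_; _<?_; _≤?_; z≤n; s≤s)
  open import Data.Bool using (true; false; not; _∧_; _∨_; if_then_else_; T)
  open import Data.Bool.Properties using (if-float; ∧-zeroʳ)
  open import Data.Fin.Permutation using (_⟨$⟩ʳ_; _⟨$⟩ˡ_; inverseʳ)
  open import Data.Unit using (tt)
  open import Data.Product using (_,_; proj₁)
  import Data.Fin.Properties as Fin
  open import Relation.Nullary using (yes; no; contradiction)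
  open import Relation.Nullary.Decidable using (⌊_⌋; isYes≗does; dec-false)
  open import Data.Nat.Properties
  open import Data.Nat.Tactic.RingSolver using (solve-∀; solve)
  open import Data.List using (_∷_; [])
  open import Algebra.Properties.Semiring.Sum +-*-semiring
  open import Algebra.Properties.CommutativeSemigroup *-commutativeSemigroup using (x∙yz≈y∙xz)
  open ≤-Reasoning

  sum-mono-≤ : ∀ {n} {f g : Fin n → ℕ} → (∀ i → f i ≤ g i) → sum f ≤ sum g
  sum-mono-≤ {zero}  _   = z≤n
  sum-mono-≤ {suc n} f≤g = +-mono-≤ (f≤g Fin.zero) (sum-mono-≤ (f≤g ∘ Fin.suc))

  sum-const : ∀ n c → sum {n} (λ _ → c) ≡ n * c
  sum-const zero    c = refl
  sum-const (suc n) c = cong (c +_) (sum-const n c)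

  sum-below : ∀ {n k} x y → k ≤ n → sum {n} (λ j → if toℕ j <ᵇ k then x else y) ≡ k * x + (n ∸ k) * y
  sum-below {zero}  x y z≤n         = refl
  sum-below {suc n} x y z≤n         = cong (y +_) (sum-const n y)
  sum-below {suc n} x y (s≤s k≤n) = trans (cong (x +_) (sum-below x y k≤n)) (sym (+-assoc x _ _))

  ≥⇒≮ᵇ : ∀ {m k} → k ≤ m → (m <ᵇ k) ≡ false
  ≥⇒≮ᵇ {m} {k} k≤m with m <ᵇ k in m<ᵇk
  ... | false = refl
  ... | true  = contradiction (<ᵇ⇒< m k (subst T (sym m<ᵇk) tt)) (≤⇒≯ k≤m)

  ≮ᵇ⇒≥ : ∀ {m k} → (m <ᵇ k) ≡ false → k ≤ m
  ≮ᵇ⇒≥ m≮k = ≮⇒≥ (λ m<k → subst T m≮k (<⇒<ᵇ m<k))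

  -- (D − x)(D − y) ≥ 0, without subtraction
  product-bound : ∀ {D x y} → x ≤ D → y ≤ D → D * x + D * y ≤ D * D + x * y
  product-bound {D} {x} {y} x≤D = subst (λ D → y ≤ D → D * x + D * y ≤ D * D + x * y) (m+[n∸m]≡n x≤D) (bound (D ∸ x))
    where
    bound : ∀ p → y ≤ x + p → (x + p) * x + (x + p) * y ≤ (x + p) * (x + p) + x * y
    bound p y≤x+p = begin
      (x + p) * x + (x + p) * y         ≡⟨ solve (x ∷ p ∷ y ∷ []) ⟩
      (x * x + x * y + p * x) + p * y   ≤⟨ +-monoʳ-≤ (x * x + x * y + p * x) (*-monoʳ-≤ p y≤x+p) ⟩
      (x * x + x * y + p * x) + p * (x + p) ≡⟨ solve (x ∷ p ∷ y ∷ []) ⟩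
      (x + p) * (x + p) + x * y         ∎

  eliminate-cross-term : ∀ {D δ S M P} → δ ≤ D →
                         D * M + D * M ≤ S * (D * D) + P → P + M + S * (D * δ) ≤ S * S + M * δ →
                         suc (D + (D ∸ δ)) * M ≤ S * (S + D * (D ∸ δ))
  eliminate-cross-term {D} {δ} {S} {M} {P} δ≤D upper lower =
    subst (λ D → D * M + D * M ≤ S * (D * D) + P → P + M + S * (D * δ) ≤ S * S + M * δ →
                 suc (D + (D ∸ δ)) * M ≤ S * (S + D * (D ∸ δ)))
          (m+[n∸m]≡n δ≤D) (combine (D ∸ δ)) upper lower
    where
    combine : ∀ r → let D = δ + r in
              D * M + D * M ≤ S * (D * D) + P → P + M + S * (D * δ) ≤ S * S + M * δ →
              suc (D + (D ∸ δ)) * M ≤ S * (S + D * (D ∸ δ))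
    combine r upper lower rewrite m+n∸m≡n δ r = +-cancelʳ-≤ (M * δ + S * ((δ + r) * δ)) _ _ (begin
      suc (δ + r + r) * M + (M * δ + S * ((δ + r) * δ))
        ≡⟨ solve (δ ∷ r ∷ S ∷ M ∷ []) ⟩
      ((δ + r) * M + (δ + r) * M) + (M + S * ((δ + r) * δ))
        ≤⟨ +-monoˡ-≤ (M + S * ((δ + r) * δ)) upper ⟩
      (S * ((δ + r) * (δ + r)) + P) + (M + S * ((δ + r) * δ))
        ≡⟨ solve (δ ∷ r ∷ S ∷ M ∷ P ∷ []) ⟩
      S * ((δ + r) * (δ + r)) + (P + M + S * ((δ + r) * δ))
        ≤⟨ +-monoʳ-≤ (S * ((δ + r) * (δ + r))) lower ⟩
      S * ((δ + r) * (δ + r)) + (S * S + M * δ)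
        ≡⟨ solve (δ ∷ r ∷ S ∷ M ∷ []) ⟩
      S * (S + (δ + r) * r) + (M * δ + S * ((δ + r) * δ)) ∎)

  2*[1+D]∸1∸δ≡1+D+[D∸δ] : ∀ {D δ} → δ ≤ D → 2 * suc D ∸ 1 ∸ δ ≡ suc (D + (D ∸ δ))
  2*[1+D]∸1∸δ≡1+D+[D∸δ] {D} {δ} δ≤D = trans (cong (_∸ δ) (trans (cong (D +_) (+-identityʳ (suc D))) (+-suc D D)))
                                         (+-∸-assoc (suc D) δ≤D)

  module _ {k D : ℕ} (k≤D : k ≤ D) where

    private
      S M : ℕ
      S = k * D + (suc D ∸ k) * k
      M = k * (D * D) + (suc D ∸ k) * (k * k)

      suc[k+r]∸k : ∀ r → suc (k + r) ∸ k ≡ suc r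
      suc[k+r]∸k r = trans (cong (_∸ k) (sym (+-suc k r))) (m+n∸m≡n k (suc r))

    CS-degreeSum-identity : S ≡ (2 * suc D ∸ 1) * k ∸ k * k
    CS-degreeSum-identity = subst (λ D → k * D + (suc D ∸ k) * k ≡ (2 * suc D ∸ 1) * k ∸ k * k)
                                  (m+[n∸m]≡n k≤D) (identity (D ∸ k))
      where
      identity : ∀ r → k * (k + r) + (suc (k + r) ∸ k) * k ≡ (2 * suc (k + r) ∸ 1) * k ∸ k * k
      identity r rewrite suc[k+r]∸k r =
        sym (trans (cong (_∸ k * k) (expand k r)) (m+n∸m≡n (k * k) (k * (k + r) + suc r * k)))
        where
        expand : ∀ k r → (k + r + (suc (k + r) + 0)) * k ≡ k * k + (k * (k + r) + suc r * k)
        expand = solve-∀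

    CS-zagreb-identity : suc (D + (D ∸ k)) * M ≡ S * (S + D * (D ∸ k))
    CS-zagreb-identity = subst (λ D → suc (D + (D ∸ k)) * (k * (D * D) + (suc D ∸ k) * (k * k))
                                      ≡ (k * D + (suc D ∸ k) * k) * (k * D + (suc D ∸ k) * k + D * (D ∸ k)))
                               (m+[n∸m]≡n k≤D) (identity (D ∸ k))
      where
      identity : ∀ r → suc ((k + r) + (k + r ∸ k)) * (k * ((k + r) * (k + r)) + (suc (k + r) ∸ k) * (k * k))
                     ≡ (k * (k + r) + (suc (k + r) ∸ k) * k) * (k * (k + r) + (suc (k + r) ∸ k) * k + (k + r) * (k + r ∸ k))
      identity r rewrite suc[k+r]∸k r | m+n∸m≡n k r = solve (k ∷ r ∷ [])

  module _ {n} (G : Graph n) where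

    private
      d : Fin n → ℕ
      d = degree G

    adjacency nonAdjacency : Fin n → Fin n → ℕ
    adjacency    i j = 𝟙 (adj G i j)
    nonAdjacency i j = 𝟙 (not (adj G i j))

    adjacency-sym : ∀ i j → adjacency i j ≡ adjacency j i
    adjacency-sym i j = cong 𝟙 (adj-sym G i j)

    adjacency+nonAdjacency : ∀ i j → adjacency i j + nonAdjacency i j ≡ 1
    adjacency+nonAdjacency i j with adj G i j
    ... | true  = refl
    ... | false = refl

    degree≡sum : ∀ i → degree G i ≡ sum (adjacency i)
    degree≡sum i = foldr-map-allFin _+_ 0 (adjacency i)

    M₁≡sum : M₁ G ≡ sum (λ i → d i * d i)
    M₁≡sum = foldr-map-allFin _+_ 0 (λ i → d i * d i)

    handshake : 2 * edges G ≡ sum d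
    handshake = begin-equality
      2 * edges G                                  ≡⟨ cong (2 *_) edges≡sum ⟩
      2 * E                                        ≡⟨ cong (E +_) (+-identityʳ E) ⟩
      E + E                                        ≡⟨ cong (E +_) (∑-comm forward) ⟩
      E + sum (λ i → sum (λ j → forward j i))     ≡⟨ ∑-distrib-+ (λ i → sum (forward i)) _ ⟨
      sum (λ i → sum (forward i) + sum (λ j → forward j i))
        ≡⟨ sum-cong-≗ (λ i → ∑-distrib-+ (forward i) _) ⟨
      sum (λ i → sum (λ j → forward i j + forward j i))
        ≡⟨ sum-cong-≗ (λ i → sum-cong-≗ (forward+backward i)) ⟩
      sum (λ i → sum (adjacency i))               ≡⟨ sum-cong-≗ degree≡sum ⟨
      sum d                                        ∎
      where
      forward : Fin n → Fin n → ℕ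
      forward i j = 𝟙 (⌊ toℕ i <? toℕ j ⌋ ∧ adj G i j)

      E : ℕ
      E = sum (λ i → sum (forward i))

      edges≡sum : edges G ≡ E
      edges≡sum = trans (foldr-map-allFin _+_ 0 {n} _) (sum-cong-≗ (λ i → foldr-map-allFin _+_ 0 (forward i)))

      forward+backward : ∀ i j → forward i j + forward j i ≡ adjacency i j
      forward+backward i j with toℕ i <? toℕ j | toℕ j <? toℕ i
      ... | yes i<j | yes j<i = contradiction j<i (<-asym i<j)
      ... | yes _   | no _    = +-identityʳ _
      ... | no _    | yes _   = adjacency-sym j i
      ... | no i≮j  | no j≮i with Fin.toℕ-injective (≤-antisym (≮⇒≥ j≮i) (≮⇒≥ i≮j))
      ...   | refl = cong 𝟙 (sym (adj-irrefl G i))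

    adjacentSum : (Fin n → Fin n → ℕ) → ℕ
    adjacentSum f = sum (λ i → sum (λ j → adjacency i j * f i j))

    adjacentSum-mono-≤ : ∀ {f g : Fin n → Fin n → ℕ} → (∀ i j → f i j ≤ g i j) → adjacentSum f ≤ adjacentSum g
    adjacentSum-mono-≤ f≤g = sum-mono-≤ (λ i → sum-mono-≤ (λ j → *-monoʳ-≤ (adjacency i j) (f≤g i j)))

    adjacentSum-+ : ∀ (f g : Fin n → Fin n → ℕ) → adjacentSum (λ i j → f i j + g i j) ≡ adjacentSum f + adjacentSum g
    adjacentSum-+ f g = trans (sum-cong-≗ λ i → trans (sum-cong-≗ λ j → *-distribˡ-+ (adjacency i j) (f i j) (g i j))
                                                      (∑-distrib-+ (λ j → adjacency i j * f i j) (λ j → adjacency i j * g i j)))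
                              (∑-distrib-+ (λ i → sum (λ j → adjacency i j * f i j)) (λ i → sum (λ j → adjacency i j * g i j)))

    adjacentSum-*ˡ : ∀ c (f : Fin n → Fin n → ℕ) → adjacentSum (λ i j → c * f i j) ≡ c * adjacentSum f
    adjacentSum-*ˡ c f = trans (sum-cong-≗ λ i → trans (sum-cong-≗ λ j → x∙yz≈y∙xz (adjacency i j) c (f i j))
                                                        (sym (*-distribˡ-sum c (λ j → adjacency i j * f i j))))
                               (sym (*-distribˡ-sum c (λ i → sum (λ j → adjacency i j * f i j))))

    adjacentSum-factor : ∀ (f g : Fin n → ℕ) → adjacentSum (λ i j → f i * g j) ≡ sum (λ i → f i * sum (λ j → adjacency i j * g j))
    adjacentSum-factor f g = sum-cong-≗ λ i → trans (sum-cong-≗ λ j → x∙yz≈y∙xz (adjacency i j) (f i) (g j))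
                                                     (sym (*-distribˡ-sum (f i) (λ j → adjacency i j * g j)))

    adjacentSum-source : ∀ (f : Fin n → ℕ) → adjacentSum (λ i _ → f i) ≡ sum (λ i → d i * f i)
    adjacentSum-source f = sum-cong-≗ λ i → trans (sym (*-distribʳ-sum (f i) (adjacency i))) (cong (_* f i) (sym (degree≡sum i)))

    adjacentSum-flip : ∀ (f : Fin n → Fin n → ℕ) → adjacentSum f ≡ adjacentSum (λ i j → f j i)
    adjacentSum-flip f = trans (∑-comm (λ i j → adjacency i j * f i j))
                               (sum-cong-≗ λ j → sum-cong-≗ λ i → cong (_* f i j) (adjacency-sym i j))

    edge-bound : ∀ {D} → (∀ i → d i ≤ D) →
                 D * M₁ G + D * M₁ G ≤ sum d * (D * D) + adjacentSum (λ i j → d i * d j)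
    edge-bound {D} d≤D = begin
      D * M₁ G + D * M₁ G                              ≡⟨ cong₂ (λ u v → D * u + D * v) M₁≡source M₁≡target ⟩
      D * adjacentSum (λ i _ → d i) + D * adjacentSum (λ _ j → d j)
        ≡⟨ cong₂ _+_ (adjacentSum-*ˡ D _) (adjacentSum-*ˡ D _) ⟨
      adjacentSum (λ i _ → D * d i) + adjacentSum (λ _ j → D * d j)
        ≡⟨ adjacentSum-+ _ _ ⟨
      adjacentSum (λ i j → D * d i + D * d j)          ≤⟨ adjacentSum-mono-≤ (λ i j → product-bound (d≤D i) (d≤D j)) ⟩
      adjacentSum (λ i j → D * D + d i * d j)          ≡⟨ adjacentSum-+ _ _ ⟩
      adjacentSum (λ _ _ → D * D) + adjacentSum (λ i j → d i * d j)
        ≡⟨ cong (_+ adjacentSum (λ i j → d i * d j)) (trans (adjacentSum-source (λ _ → D * D)) (sym (*-distribʳ-sum (D * D) d))) ⟩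
      sum d * (D * D) + adjacentSum (λ i j → d i * d j) ∎
      where
      M₁≡source : M₁ G ≡ adjacentSum (λ i _ → d i)
      M₁≡source = trans M₁≡sum (sym (adjacentSum-source d))

      M₁≡target : M₁ G ≡ adjacentSum (λ _ j → d j)
      M₁≡target = trans M₁≡source (adjacentSum-flip _)

  module _ {D} (G : Graph (suc D)) where

    private
      d : Fin (suc D) → ℕ
      d = degree G

    otherNonNeighbours : Fin (suc D) → ℕ
    otherNonNeighbours i = sum (Vector.removeAt (nonAdjacency G i) i)

    nonAdjacency-refl : ∀ i → nonAdjacency G i i ≡ 1
    nonAdjacency-refl i = cong (𝟙 ∘ not) (adj-irrefl G i)

    degree+otherNonNeighbours : ∀ i → d i + otherNonNeighbours i ≡ D
    degree+otherNonNeighbours i = suc-injective (begin-equality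
      suc (d i + otherNonNeighbours i)                ≡⟨ +-suc (d i) _ ⟨
      d i + (1 + otherNonNeighbours i)                ≡⟨ cong (λ b → d i + (b + otherNonNeighbours i)) (nonAdjacency-refl i) ⟨
      d i + (nonAdjacency G i i + otherNonNeighbours i) ≡⟨ cong (d i +_) (sum-remove (nonAdjacency G i)) ⟨
      d i + sum (nonAdjacency G i)                    ≡⟨ cong (_+ sum (nonAdjacency G i)) (degree≡sum G i) ⟩
      sum (adjacency G i) + sum (nonAdjacency G i)    ≡⟨ ∑-distrib-+ (adjacency G i) (nonAdjacency G i) ⟨
      sum (λ j → adjacency G i j + nonAdjacency G i j) ≡⟨ sum-cong-≗ (adjacency+nonAdjacency G i) ⟩
      sum {suc D} (λ _ → 1)                           ≡⟨ sum-const (suc D) 1 ⟩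
      suc D * 1                                       ≡⟨ *-identityʳ (suc D) ⟩
      suc D                                           ∎)

    degree≤ : ∀ i → d i ≤ D
    degree≤ i = subst (d i ≤_) (degree+otherNonNeighbours i) (m≤m+n (d i) _)

    module _ {δ} (δ≤d : ∀ j → δ ≤ d j) where

      nonNeighbourDegreeSum-bound : ∀ i → d i + otherNonNeighbours i * δ ≤ sum (λ j → nonAdjacency G i j * d j)
      nonNeighbourDegreeSum-bound i = begin
        d i + otherNonNeighbours i * δ                        ≡⟨ cong (d i +_) (*-distribʳ-sum δ (b ∘ Fin.punchIn i)) ⟩
        d i + sum (λ j → b (Fin.punchIn i j) * δ)              ≤⟨ +-monoʳ-≤ (d i) (sum-mono-≤ λ j → *-monoʳ-≤ (b (Fin.punchIn i j)) (δ≤d _)) ⟩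
        d i + sum (Vector.removeAt (λ j → b j * d j) i)        ≡⟨ cong (_+ sum (Vector.removeAt (λ j → b j * d j) i)) (trans (cong (_* d i) (nonAdjacency-refl i)) (*-identityˡ (d i))) ⟨
        b i * d i + sum (Vector.removeAt (λ j → b j * d j) i)  ≡⟨ sum-remove (λ j → b j * d j) ⟨
        sum (λ j → b j * d j)                                  ∎
        where
        b : Fin (suc D) → ℕ
        b = nonAdjacency G i

      neighbourDegreeSum-bound : ∀ i → sum (λ j → adjacency G i j * d j) + d i + D * δ ≤ sum d + d i * δ
      neighbourDegreeSum-bound i = begin
        A + d i + D * δ                            ≡⟨ cong (λ x → A + d i + x * δ) (degree+otherNonNeighbours i) ⟨
        A + d i + (d i + otherNonNeighbours i) * δ ≡⟨ regroup A (d i) (otherNonNeighbours i) δ ⟩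
        A + (d i + otherNonNeighbours i * δ) + d i * δ
          ≤⟨ +-monoˡ-≤ (d i * δ) (+-monoʳ-≤ A (nonNeighbourDegreeSum-bound i)) ⟩
        A + B + d i * δ                            ≡⟨ cong (_+ d i * δ) split ⟩
        sum d + d i * δ                            ∎
        where
        A B : ℕ
        A = sum (λ j → adjacency G i j * d j)
        B = sum (λ j → nonAdjacency G i j * d j)

        regroup : ∀ a x y z → a + x + (x + y) * z ≡ a + (x + y * z) + x * z
        regroup = solve-∀

        split : A + B ≡ sum d
        split = trans (sym (∑-distrib-+ (λ j → adjacency G i j * d j) (λ j → nonAdjacency G i j * d j)))
                      (sum-cong-≗ λ j → trans (sym (*-distribʳ-+ (d j) (adjacency G i j) (nonAdjacency G i j)))
                                              (trans (cong (_* d j) (adjacency+nonAdjacency G i j)) (*-identityˡ (d j))))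

      degree-square-bound : adjacentSum G (λ i j → d i * d j) + M₁ G + sum d * (D * δ) ≤ sum d * sum d + M₁ G * δ
      degree-square-bound = begin
        adjacentSum G (λ i j → d i * d j) + M₁ G + sum d * (D * δ)
          ≡⟨ cong₂ (λ x y → x + y + sum d * (D * δ)) (adjacentSum-factor G d d) (M₁≡sum G) ⟩
        sum (λ i → d i * A i) + sum (λ i → d i * d i) + sum d * (D * δ)
          ≡⟨ cong (sum (λ i → d i * A i) + sum (λ i → d i * d i) +_) (*-distribʳ-sum (D * δ) d) ⟩
        sum (λ i → d i * A i) + sum (λ i → d i * d i) + sum (λ i → d i * (D * δ))
          ≡⟨ cong (_+ sum (λ i → d i * (D * δ))) (∑-distrib-+ (λ i → d i * A i) (λ i → d i * d i)) ⟨
        sum (λ i → d i * A i + d i * d i) + sum (λ i → d i * (D * δ))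
          ≡⟨ ∑-distrib-+ (λ i → d i * A i + d i * d i) (λ i → d i * (D * δ)) ⟨
        sum (λ i → d i * A i + d i * d i + d i * (D * δ))
          ≡⟨ sum-cong-≗ (λ i → expand-left (d i) (A i) (D * δ)) ⟩
        sum (λ i → d i * (A i + d i + D * δ))
          ≤⟨ sum-mono-≤ (λ i → *-monoʳ-≤ (d i) (neighbourDegreeSum-bound i)) ⟩
        sum (λ i → d i * (sum d + d i * δ))
          ≡⟨ sum-cong-≗ (λ i → expand-right (d i) (sum d) δ) ⟩
        sum (λ i → d i * sum d + d i * d i * δ)
          ≡⟨ ∑-distrib-+ (λ i → d i * sum d) (λ i → d i * d i * δ) ⟩
        sum (λ i → d i * sum d) + sum (λ i → d i * d i * δ)
          ≡⟨ cong₂ _+_ (*-distribʳ-sum (sum d) d) (*-distribʳ-sum δ (λ i → d i * d i)) ⟨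
        sum d * sum d + sum (λ i → d i * d i) * δ
          ≡⟨ cong (λ m → sum d * sum d + m * δ) (M₁≡sum G) ⟨
        sum d * sum d + M₁ G * δ ∎
        where
        A : Fin (suc D) → ℕ
        A i = sum (λ j → adjacency G i j * d j)

        expand-left : ∀ x a c → x * a + x * x + x * c ≡ x * (a + x + c)
        expand-left = solve-∀

        expand-right : ∀ x s z → x * (s + x * z) ≡ x * s + x * x * z
        expand-right = solve-∀

      zagreb-bound : suc (D + (D ∸ δ)) * M₁ G ≤ 2 * edges G * (2 * edges G + D * (D ∸ δ))
      zagreb-bound = subst (λ S → suc (D + (D ∸ δ)) * M₁ G ≤ S * (S + D * (D ∸ δ))) (sym (handshake G))
        (eliminate-cross-term {S = sum d} {P = adjacentSum G (λ i j → d i * d j)} (≤-trans (δ≤d Fin.zero) (degree≤ Fin.zero)) (edge-bound G degree≤) degree-square-bound)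

  degree-≅ : ∀ {n} {G H : Graph n} ((σ , _) : G ≅ H) i → degree G i ≡ degree H (σ ⟨$⟩ʳ i)
  degree-≅ {G = G} {H} (σ , σ-adj) i = begin-equality
    degree G i                                  ≡⟨ degree≡sum G i ⟩
    sum (adjacency G i)                         ≡⟨ sum-cong-≗ (λ j → cong 𝟙 (σ-adj i j)) ⟩
    sum (λ j → adjacency H (σ ⟨$⟩ʳ i) (σ ⟨$⟩ʳ j)) ≡⟨ sum-permute (adjacency H (σ ⟨$⟩ʳ i)) σ ⟨
    sum (adjacency H (σ ⟨$⟩ʳ i))                ≡⟨ degree≡sum H (σ ⟨$⟩ʳ i) ⟨
    degree H (σ ⟨$⟩ʳ i)                         ∎

  sum-degree-≅ : ∀ {n} {G H : Graph n} → G ≅ H → ∀ g → sum (λ i → g (degree G i)) ≡ sum (λ i → g (degree H i))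
  sum-degree-≅ {G = G} {H} iso@(σ , _) g = trans (sum-cong-≗ (λ i → cong g (degree-≅ {G = G} {H} iso i)))
                                             (sym (sum-permute (λ i → g (degree H i)) σ))

  adj-CS : ∀ {n k} (i j : Fin n) → adj (CS n k) i j ≡ not ⌊ i Fin.≟ j ⌋ ∧ ((toℕ i <ᵇ k) ∨ (toℕ j <ᵇ k))
  adj-CS {k = k} i j = cong₂ (λ x y → not ⌊ i Fin.≟ j ⌋ ∧ (x ∨ y)) (isYes≗does (toℕ i <? k)) (isYes≗does (toℕ j <? k))

  module _ {D k : ℕ} where

    private
      H : Graph (suc D)
      H = CS (suc D) k

    degree-CS-clique : ∀ i → (toℕ i <ᵇ k) ≡ true → degree H i ≡ D
    degree-CS-clique i inClique = begin-equality
      degree H i                                                ≡⟨ degree≡sum H i ⟩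
      sum (adjacency H i)                                       ≡⟨ sum-remove (adjacency H i) ⟩
      adjacency H i i + sum (Vector.removeAt (adjacency H i) i) ≡⟨ cong₂ _+_ (cong 𝟙 (adj-irrefl H i)) (sum-cong-≗ adjacent) ⟩
      sum {D} (λ _ → 1)                                         ≡⟨ trans (sum-const D 1) (*-identityʳ D) ⟩
      D                                                         ∎
      where
      adjacent : ∀ j → adjacency H i (Fin.punchIn i j) ≡ 1
      adjacent j rewrite adj-CS {k = k} i (Fin.punchIn i j) | inClique
                       | trans (isYes≗does (i Fin.≟ Fin.punchIn i j)) (dec-false (i Fin.≟ _) (Fin.punchInᵢ≢i i j ∘ sym)) = refl

    degree-CS-independent : ∀ i → (toℕ i <ᵇ k) ≡ false → degree H i ≡ k
    degree-CS-independent i notInClique = begin-equality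
      degree H i                                          ≡⟨ degree≡sum H i ⟩
      sum (adjacency H i)                                 ≡⟨ sum-cong-≗ clique-indicator ⟩
      sum {suc D} (λ j → if toℕ j <ᵇ k then 1 else 0)     ≡⟨ sum-below {suc D} {k} 1 0 (≤-trans (≮ᵇ⇒≥ notInClique) (<⇒≤ (Fin.toℕ<n i))) ⟩
      k * 1 + (suc D ∸ k) * 0                             ≡⟨ cong₂ _+_ (*-identityʳ k) (*-zeroʳ (suc D ∸ k)) ⟩
      k + 0                                               ≡⟨ +-identityʳ k ⟩
      k                                                   ∎
      where
      clique-indicator : ∀ j → adjacency H i j ≡ (if toℕ j <ᵇ k then 1 else 0)
      clique-indicator j rewrite adj-CS {k = k} i j | notInClique with toℕ j <ᵇ k in jInClique | i Fin.≟ j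
      ... | false | _        = cong 𝟙 (∧-zeroʳ _)
      ... | true  | no _     = refl
      ... | true  | yes refl = contradiction (trans (sym notInClique) jInClique) λ ()

    degree-CS : ∀ i → degree H i ≡ (if toℕ i <ᵇ k then D else k)
    degree-CS i = by-membership (toℕ i <ᵇ k) refl
      where
      by-membership : ∀ b → (toℕ i <ᵇ k) ≡ b → degree H i ≡ (if b then D else k)
      by-membership true  = degree-CS-clique i
      by-membership false = degree-CS-independent i

    CS-regular : D ≤ k → ∀ i → degree H i ≡ D
    CS-regular D≤k i = by-membership (toℕ i <ᵇ k) refl
      where
      by-membership : ∀ b → (toℕ i <ᵇ k) ≡ b → degree H i ≡ D
      by-membership true  = degree-CS-clique i
      by-membership false notInClique = trans (degree-CS-independent i notInClique)
                                              (≤-antisym (≤-trans (≮ᵇ⇒≥ notInClique) (≤-pred (Fin.toℕ<n i))) D≤k)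

    k≤degree-CS : k ≤ D → ∀ i → k ≤ degree H i
    k≤degree-CS k≤D i = subst (k ≤_) (sym (degree-CS i)) (bounded (toℕ i <ᵇ k))
      where
      bounded : ∀ b → k ≤ (if b then D else k)
      bounded true  = k≤D
      bounded false = ≤-refl

  module _ {D k} {G : Graph (suc D)} (G≅CS : G ≅ CS (suc D) k) where

    private
      σ = proj₁ G≅CS

      degree-σ : ∀ i → degree G i ≡ degree (CS (suc D) k) (σ ⟨$⟩ʳ i)
      degree-σ = degree-≅ {G = G} {CS (suc D) k} G≅CS

    sum-degree-CS : k ≤ suc D → ∀ g → sum (λ i → g (degree G i)) ≡ k * g D + (suc D ∸ k) * g k
    sum-degree-CS k≤n g = begin-equality
      sum (λ i → g (degree G i))                      ≡⟨ sum-degree-≅ {G = G} {CS (suc D) k} G≅CS g ⟩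
      sum (λ i → g (degree (CS (suc D) k) i))         ≡⟨ sum-cong-≗ (λ i → trans (cong g (degree-CS {D} {k} i)) (if-float g (toℕ i <ᵇ k))) ⟩
      sum {suc D} (λ i → if toℕ i <ᵇ k then g D else g k) ≡⟨ sum-below (g D) (g k) k≤n ⟩
      k * g D + (suc D ∸ k) * g k                     ∎

    CS-irregular⇒k<D : Irregular G → k < D
    CS-irregular⇒k<D (i , j , dᵢ≢dⱼ) with suc k ≤? D
    ... | yes k<D = k<D
    ... | no  k≮D = contradiction (trans (regular i) (sym (regular j))) dᵢ≢dⱼ
      where
      regular : ∀ i → degree G i ≡ D
      regular i = trans (degree-σ i) (CS-regular (≮⇒≥ k≮D) (σ ⟨$⟩ʳ i))

    minDegree-CS : ∀ {δ} → k < D → IsMinDegree G δ → δ ≡ k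
    minDegree-CS {δ} k<D ((i , dᵢ≡δ) , δ≤d) = ≤-antisym δ≤k k≤δ
      where
      last : Fin (suc D)
      last = σ ⟨$⟩ˡ Fin.fromℕ D

      δ≤k : δ ≤ k
      δ≤k = subst (δ ≤_) (trans (degree-σ last)
                                (trans (cong (degree (CS (suc D) k)) (inverseʳ σ))
                                       (degree-CS-independent (Fin.fromℕ D)
                                          (≥⇒≮ᵇ (subst (k ≤_) (sym (Fin.toℕ-fromℕ D)) (<⇒≤ k<D))))))
                         (δ≤d last)

      k≤δ : k ≤ δ
      k≤δ = subst (k ≤_) (trans (sym (degree-σ i)) dᵢ≡δ) (k≤degree-CS (<⇒≤ k<D) (σ ⟨$⟩ʳ i))

  module _ {D k} {G : Graph (suc D)} (G≅CS : G ≅ CS (suc D) k) (k≤D : k ≤ D) where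

    private
      k≤1+D : k ≤ suc D
      k≤1+D = m≤n⇒m≤1+n k≤D

    degreeSum-CS : 2 * edges G ≡ k * D + (suc D ∸ k) * k
    degreeSum-CS = trans (handshake G) (sum-degree-CS {G = G} G≅CS k≤1+D id)

    edges-CS : 2 * edges G ≡ (2 * suc D ∸ 1) * k ∸ k * k
    edges-CS = trans degreeSum-CS (CS-degreeSum-identity k≤D)

    zagreb-CS : suc (D + (D ∸ k)) * M₁ G ≡ 2 * edges G * (2 * edges G + D * (D ∸ k))
    zagreb-CS = begin-equality
      suc (D + (D ∸ k)) * M₁ G
        ≡⟨ cong (suc (D + (D ∸ k)) *_) (trans (M₁≡sum G) (sum-degree-CS {G = G} G≅CS k≤1+D (λ x → x * x))) ⟩
      suc (D + (D ∸ k)) * (k * (D * D) + (suc D ∸ k) * (k * k))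
        ≡⟨ CS-zagreb-identity k≤D ⟩
      S * (S + D * (D ∸ k))
        ≡⟨ cong (λ S → S * (S + D * (D ∸ k))) degreeSum-CS ⟨
      2 * edges G * (2 * edges G + D * (D ∸ k)) ∎
      where
      S = k * D + (suc D ∸ k) * k

module Rationals where

  open import Data.Nat as ℕ using ()
  import Data.Nat.Properties as ℕ
  open import Data.Integer as ℤ using (+_)
  import Data.Integer.Properties as ℤ
  open import Data.Integer.Tactic.RingSolver using (solve-∀)
  open import Data.Rational as ℚ using (ℚ; 0ℚ; 1ℚ; _+_; _*_; _-_; _≤_)
  import Data.Rational.Properties as ℚ
  open import Data.Rational.Unnormalised as ℚᵘ using (mkℚᵘ; *≡*; *≤*)
  import Data.Rational.Unnormalised.Properties as ℚᵘ
  open import Data.Rational.Solver using (module +-*-Solver)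
  open +-*-Solver using (solve; _:+_; _:*_; _:-_; _:=_; con)
  import Algebra.Properties.Semiring.Sum as Sum
  open import Algebra.Properties.Monoid.Sum ℚ.+-0-monoid using (sum)
  private module ℕΣ = Sum ℕ.+-*-semiring

  fromℚᵘ-homo-+ : ∀ p q → ℚ.fromℚᵘ (p ℚᵘ.+ q) ≡ ℚ.fromℚᵘ p + ℚ.fromℚᵘ q
  fromℚᵘ-homo-+ p q = ℚ.toℚᵘ-injective (ℚᵘ.≃-trans (ℚ.toℚᵘ-fromℚᵘ (p ℚᵘ.+ q))
    (ℚᵘ.≃-sym (ℚᵘ.≃-trans (ℚ.toℚᵘ-homo-+ (ℚ.fromℚᵘ p) (ℚ.fromℚᵘ q))
                          (ℚᵘ.+-cong (ℚ.toℚᵘ-fromℚᵘ p) (ℚ.toℚᵘ-fromℚᵘ q)))))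

  fromℚᵘ-homo-* : ∀ p q → ℚ.fromℚᵘ (p ℚᵘ.* q) ≡ ℚ.fromℚᵘ p * ℚ.fromℚᵘ q
  fromℚᵘ-homo-* p q = ℚ.toℚᵘ-injective (ℚᵘ.≃-trans (ℚ.toℚᵘ-fromℚᵘ (p ℚᵘ.* q))
    (ℚᵘ.≃-sym (ℚᵘ.≃-trans (ℚ.toℚᵘ-homo-* (ℚ.fromℚᵘ p) (ℚ.fromℚᵘ q))
                          (ℚᵘ.*-cong (ℚ.toℚᵘ-fromℚᵘ p) (ℚ.toℚᵘ-fromℚᵘ q)))))

  ⟦⟧-homo-+ : ∀ a b → ⟦ a ℕ.+ b ⟧ ≡ ⟦ a ⟧ + ⟦ b ⟧
  ⟦⟧-homo-+ a b = trans (ℚ.fromℚᵘ-cong {mkℚᵘ (+ (a ℕ.+ b)) 0} {mkℚᵘ (+ a) 0 ℚᵘ.+ mkℚᵘ (+ b) 0} (*≡* (trans (cong (ℤ._* + 1) (ℤ.pos-+ a b)) (+-identities (+ a) (+ b)))))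
                        (fromℚᵘ-homo-+ (mkℚᵘ (+ a) 0) (mkℚᵘ (+ b) 0))
    where
    +-identities : ∀ x y → (x ℤ.+ y) ℤ.* + 1 ≡ (x ℤ.* + 1 ℤ.+ y ℤ.* + 1) ℤ.* + 1
    +-identities = solve-∀

  ⟦⟧-homo-* : ∀ a b → ⟦ a ℕ.* b ⟧ ≡ ⟦ a ⟧ * ⟦ b ⟧
  ⟦⟧-homo-* a b = trans (ℚ.fromℚᵘ-cong {mkℚᵘ (+ (a ℕ.* b)) 0} {mkℚᵘ (+ a) 0 ℚᵘ.* mkℚᵘ (+ b) 0} (*≡* (cong (ℤ._* + 1) (ℤ.pos-* a b))))
                        (fromℚᵘ-homo-* (mkℚᵘ (+ a) 0) (mkℚᵘ (+ b) 0))

  ⟦⟧-mono-≤ : ∀ {a b} → a ℕ.≤ b → ⟦ a ⟧ ≤ ⟦ b ⟧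
  ⟦⟧-mono-≤ {a} {b} a≤b = ℚ.toℚᵘ-cancel-≤
    (ℚᵘ.≤-respˡ-≃ (ℚᵘ.≃-sym (ℚ.toℚᵘ-fromℚᵘ (mkℚᵘ (+ a) 0)))
      (ℚᵘ.≤-respʳ-≃ (ℚᵘ.≃-sym (ℚ.toℚᵘ-fromℚᵘ (mkℚᵘ (+ b) 0)))
        (*≤* (subst₂ ℤ._≤_ (sym (ℤ.*-identityʳ (+ a))) (sym (ℤ.*-identityʳ (+ b))) (ℤ.+≤+ a≤b)))))

  ⟦⟧-homo-sum : ∀ {n} (f : Fin n → ℕ) → ⟦ ℕΣ.sum f ⟧ ≡ sum (λ i → ⟦ f i ⟧)
  ⟦⟧-homo-sum {zero}  f = refl
  ⟦⟧-homo-sum {suc n} f = trans (⟦⟧-homo-+ (f Fin.zero) _) (cong (λ s → ⟦ f Fin.zero ⟧ + s) (⟦⟧-homo-sum (f ∘ Fin.suc)))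

  sumℚ-allFin : ∀ {n} (f : Fin n → ℚ) → sumℚ (List.map f (List.allFin n)) ≡ sum f
  sumℚ-allFin = foldr-map-allFin _+_ 0ℚ

  ÷ₙ-mono-≤ : ∀ {x y} n → x ≤ y → x ÷ₙ n ≤ y ÷ₙ n
  ÷ₙ-mono-≤ zero    _   = ℚ.≤-refl
  ÷ₙ-mono-≤ (suc k) x≤y = ℚ.*-monoʳ-≤-nonNeg (+ 1 ℚ./ suc k) {{ℚ.normalize-nonNeg 1 (suc k)}} x≤y

  ⟦suc⟧-÷ₙ-self : ∀ k → ⟦ suc k ⟧ ÷ₙ suc k ≡ 1ℚ
  ⟦suc⟧-÷ₙ-self k = trans (sym (fromℚᵘ-homo-* p (ℚᵘ.1/ p))) (ℚ.fromℚᵘ-cong (ℚᵘ.*-inverseʳ p))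
    where
    p = mkℚᵘ (+ suc k) 0

  ⟦suc⟧-÷ₙ-cancel : ∀ k x → (⟦ suc k ⟧ * x) ÷ₙ suc k ≡ x
  ⟦suc⟧-÷ₙ-cancel k x = begin
    (⟦ suc k ⟧ * x) * u ≡⟨ solve 3 (λ a x u → (a :* x) :* u := x :* (a :* u)) refl ⟦ suc k ⟧ x u ⟩
    x * (⟦ suc k ⟧ * u) ≡⟨ cong (x *_) (⟦suc⟧-÷ₙ-self k) ⟩
    x * 1ℚ              ≡⟨ ℚ.*-identityʳ x ⟩
    x                   ∎
    where
    open ≡-Reasoning
    u = + 1 ℚ./ suc k

  ÷ₙ-*-÷ₙ : ∀ m k x y → (x ÷ₙ suc m) * (y ÷ₙ suc k) ≡ ((x * y) ÷ₙ suc k) ÷ₙ suc m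
  ÷ₙ-*-÷ₙ m k x y = solve 4 (λ x y u v → (x :* u) :* (y :* v) := ((x :* y) :* v) :* u) refl
                            x y (+ 1 ℚ./ suc m) (+ 1 ℚ./ suc k)

  ⟦⟧-÷ₙ-cancel : ∀ k a → ⟦ suc k ℕ.* a ⟧ ÷ₙ suc k ≡ ⟦ a ⟧
  ⟦⟧-÷ₙ-cancel k a = trans (cong (_÷ₙ suc k) (⟦⟧-homo-* (suc k) a)) (⟦suc⟧-÷ₙ-cancel k ⟦ a ⟧)

  ⟦⟧-÷ₙ-*-÷ₙ : ∀ m k b c → (⟦ b ⟧ ÷ₙ suc m) * (⟦ c ⟧ ÷ₙ suc k) ≡ (⟦ b ℕ.* c ⟧ ÷ₙ suc k) ÷ₙ suc m
  ⟦⟧-÷ₙ-*-÷ₙ m k b c = trans (÷ₙ-*-÷ₙ m k ⟦ b ⟧ ⟦ c ⟧) (cong (λ z → (z ÷ₙ suc k) ÷ₙ suc m) (sym (⟦⟧-homo-* b c)))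

  cross-multiply-≤ : ∀ m k {a b c} → suc k ℕ.* a ℕ.≤ b ℕ.* c → ⟦ a ⟧ ÷ₙ suc m ≤ (⟦ b ⟧ ÷ₙ suc m) * (⟦ c ⟧ ÷ₙ suc k)
  cross-multiply-≤ m k {a} {b} {c} ka≤bc = begin
    ⟦ a ⟧ ÷ₙ suc m                          ≡⟨ cong (_÷ₙ suc m) (⟦⟧-÷ₙ-cancel k a) ⟨
    (⟦ suc k ℕ.* a ⟧ ÷ₙ suc k) ÷ₙ suc m     ≤⟨ ÷ₙ-mono-≤ (suc m) (÷ₙ-mono-≤ (suc k) (⟦⟧-mono-≤ ka≤bc)) ⟩
    (⟦ b ℕ.* c ⟧ ÷ₙ suc k) ÷ₙ suc m         ≡⟨ ⟦⟧-÷ₙ-*-÷ₙ m k b c ⟨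
    (⟦ b ⟧ ÷ₙ suc m) * (⟦ c ⟧ ÷ₙ suc k)     ∎
    where open ℚ.≤-Reasoning

  cross-multiply-≡ : ∀ m k {a b c} → suc k ℕ.* a ≡ b ℕ.* c → ⟦ a ⟧ ÷ₙ suc m ≡ (⟦ b ⟧ ÷ₙ suc m) * (⟦ c ⟧ ÷ₙ suc k)
  cross-multiply-≡ m k {a} {b} {c} ka≡bc = begin
    ⟦ a ⟧ ÷ₙ suc m                          ≡⟨ cong (_÷ₙ suc m) (⟦⟧-÷ₙ-cancel k a) ⟨
    (⟦ suc k ℕ.* a ⟧ ÷ₙ suc k) ÷ₙ suc m     ≡⟨ cong (λ z → (⟦ z ⟧ ÷ₙ suc k) ÷ₙ suc m) ka≡bc ⟩
    (⟦ b ℕ.* c ⟧ ÷ₙ suc k) ÷ₙ suc m         ≡⟨ ⟦⟧-÷ₙ-*-÷ₙ m k b c ⟨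
    (⟦ b ⟧ ÷ₙ suc m) * (⟦ c ⟧ ÷ₙ suc k)     ∎
    where open ≡-Reasoning

  sum-squared-deviations : ∀ {n} (x : Fin n → ℚ) c →
    sum (λ i → (x i - c) * (x i - c)) ≡ sum (λ i → x i * x i) - (c + c) * sum x + ⟦ n ⟧ * (c * c)
  sum-squared-deviations {zero}  x c = solve 1 (λ c → con 0ℚ := con 0ℚ :- (c :+ c) :* con 0ℚ :+ con 0ℚ :* (c :* c)) refl c
  sum-squared-deviations {suc n} x c = begin
    (x₀ - c) * (x₀ - c) + sum (λ i → (x (Fin.suc i) - c) * (x (Fin.suc i) - c))
      ≡⟨ cong (λ s → (x₀ - c) * (x₀ - c) + s) (sum-squared-deviations (x ∘ Fin.suc) c) ⟩
    (x₀ - c) * (x₀ - c) + (Q - (c + c) * X + ⟦ n ⟧ * (c * c))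
      ≡⟨ solve 5 (λ x c Q X N → (x :- c) :* (x :- c) :+ (Q :- (c :+ c) :* X :+ N :* (c :* c))
                               := (x :* x :+ Q) :- (c :+ c) :* (x :+ X) :+ (con 1ℚ :+ N) :* (c :* c)) refl x₀ c Q X ⟦ n ⟧ ⟩
    (x₀ * x₀ + Q) - (c + c) * (x₀ + X) + (1ℚ + ⟦ n ⟧) * (c * c)
      ≡⟨ cong (λ N → (x₀ * x₀ + Q) - (c + c) * (x₀ + X) + N * (c * c)) (⟦⟧-homo-+ 1 n) ⟨
    (x₀ * x₀ + Q) - (c + c) * (x₀ + X) + ⟦ suc n ⟧ * (c * c) ∎
    where
    open ≡-Reasoning
    x₀ = x Fin.zero
    Q = sum (λ i → x (Fin.suc i) * x (Fin.suc i))
    X = sum (x ∘ Fin.suc)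

  variance-identity : ∀ {D} (x : Fin (suc D) → ℚ) {c} → c ≡ sum x ÷ₙ suc D →
    sum (λ i → (x i - c) * (x i - c)) ÷ₙ suc D ≡ (sum (λ i → x i * x i) ÷ₙ suc D) - c * c
  variance-identity {D} x refl = begin
    sum (λ i → (x i - c) * (x i - c)) * u              ≡⟨ cong (_* u) (sum-squared-deviations x c) ⟩
    (Q - (X * u + X * u) * X + ⟦ suc D ⟧ * ((X * u) * (X * u))) * u
      ≡⟨ solve 4 (λ Q X N u → (Q :- (X :* u :+ X :* u) :* X :+ N :* ((X :* u) :* (X :* u))) :* u
                           := Q :* u :- (X :* u) :* (X :* u) :+ (N :* u :- con 1ℚ) :* ((X :* u) :* (X :* u))) refl Q X ⟦ suc D ⟧ u ⟩
    Q * u - c * c + (⟦ suc D ⟧ * u - 1ℚ) * (c * c)     ≡⟨ cong (λ z → Q * u - c * c + (z - 1ℚ) * (c * c)) (⟦suc⟧-÷ₙ-self D) ⟩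
    Q * u - c * c + (1ℚ - 1ℚ) * (c * c)                 ≡⟨ solve 2 (λ A Z → A :+ (con 1ℚ :- con 1ℚ) :* Z := A) refl (Q * u - c * c) (c * c) ⟩
    Q * u - c * c                                       ∎
    where
    open ≡-Reasoning
    u = + 1 ℚ./ suc D
    Q = sum (λ i → x i * x i)
    X = sum x
    c = X * u

module Variance where

  open import Data.Nat as ℕ using (_∸_)
  import Data.Nat.Properties as ℕ
  open import Data.Rational as ℚ using (ℚ; _*_; _-_; _≤_)
  import Data.Rational.Properties as ℚ
  open import Algebra.Properties.Monoid.Sum ℚ.+-0-monoid using (sum; sum-cong-≗)
  open import Data.Product using (_×_; _,_)
  open Combinatorics
  open Rationals

  module _ {D} (G : Graph (suc D)) where

    private
      x : Fin (suc D) → ℚ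
      x i = ⟦ degree G i ⟧

    avgDeg≡mean : avgDeg G ≡ sum x ÷ₙ suc D
    avgDeg≡mean = cong (_÷ₙ suc D) (trans (cong ⟦_⟧ (handshake G)) (⟦⟧-homo-sum (degree G)))

    Var≡M₁/n-avgDeg² : Var G ≡ (⟦ M₁ G ⟧ ÷ₙ suc D) - avgDeg G * avgDeg G
    Var≡M₁/n-avgDeg² = begin
      Var G                                                     ≡⟨ cong (_÷ₙ suc D) (sumℚ-allFin (λ i → (x i - avgDeg G) * (x i - avgDeg G))) ⟩
      sum (λ i → (x i - avgDeg G) * (x i - avgDeg G)) ÷ₙ suc D  ≡⟨ variance-identity x avgDeg≡mean ⟩
      (sum (λ i → x i * x i) ÷ₙ suc D) - avgDeg G * avgDeg G    ≡⟨ cong (λ q → (q ÷ₙ suc D) - avgDeg G * avgDeg G) sum-squares ⟩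
      (⟦ M₁ G ⟧ ÷ₙ suc D) - avgDeg G * avgDeg G                 ∎
      where
      open ≡-Reasoning
      sum-squares : sum (λ i → x i * x i) ≡ ⟦ M₁ G ⟧
      sum-squares = trans (sum-cong-≗ (λ i → sym (⟦⟧-homo-* (degree G i) (degree G i))))
                          (trans (sym (⟦⟧-homo-sum (λ i → degree G i ℕ.* degree G i))) (cong ⟦_⟧ (sym (M₁≡sum G))))

    Var-bound : ∀ {δ} → (∀ j → δ ℕ.≤ degree G j) →
                Var G ≤ avgDeg G * (⟦ 2 ℕ.* edges G ℕ.+ D ℕ.* (D ∸ δ) ⟧ ÷ₙ (2 ℕ.* suc D ∸ 1 ∸ δ)) - avgDeg G * avgDeg G
    Var-bound {δ} δ≤d = begin
      Var G                                               ≡⟨ Var≡M₁/n-avgDeg² ⟩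
      (⟦ M₁ G ⟧ ÷ₙ suc D) - avgDeg G * avgDeg G           ≤⟨ ℚ.+-monoˡ-≤ (ℚ.- (avgDeg G * avgDeg G))
                                                               (cross-multiply-≤ D (D ℕ.+ (D ∸ δ)) {M₁ G} {2 ℕ.* edges G} {X} (zagreb-bound G δ≤d)) ⟩
      avgDeg G * (⟦ X ⟧ ÷ₙ suc (D ℕ.+ (D ∸ δ))) - avgDeg G * avgDeg G
        ≡⟨ cong (λ K → avgDeg G * (⟦ X ⟧ ÷ₙ K) - avgDeg G * avgDeg G)
                (2*[1+D]∸1∸δ≡1+D+[D∸δ] (ℕ.≤-trans (δ≤d Fin.zero) (degree≤ G Fin.zero))) ⟨
      avgDeg G * (⟦ X ⟧ ÷ₙ (2 ℕ.* suc D ∸ 1 ∸ δ)) - avgDeg G * avgDeg G ∎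
      where
      open ℚ.≤-Reasoning
      X = 2 ℕ.* edges G ℕ.+ D ℕ.* (D ∸ δ)

    Var-CS : ∀ {k} → G ≅ CS (suc D) k → k ℕ.≤ D →
             Var G ≡ avgDeg G * (⟦ 2 ℕ.* edges G ℕ.+ D ℕ.* (D ∸ k) ⟧ ÷ₙ (2 ℕ.* suc D ∸ 1 ∸ k)) - avgDeg G * avgDeg G
    Var-CS {k} G≅CS k≤D = begin
      Var G                                           ≡⟨ Var≡M₁/n-avgDeg² ⟩
      (⟦ M₁ G ⟧ ÷ₙ suc D) - avgDeg G * avgDeg G       ≡⟨ cong (_- avgDeg G * avgDeg G)
                                                             (cross-multiply-≡ D (D ℕ.+ (D ∸ k)) {M₁ G} {2 ℕ.* edges G} {X}
                                                                (zagreb-CS {G = G} G≅CS k≤D)) ⟩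
      avgDeg G * (⟦ X ⟧ ÷ₙ suc (D ℕ.+ (D ∸ k))) - avgDeg G * avgDeg G
        ≡⟨ cong (λ K → avgDeg G * (⟦ X ⟧ ÷ₙ K) - avgDeg G * avgDeg G) (2*[1+D]∸1∸δ≡1+D+[D∸δ] k≤D) ⟨
      avgDeg G * (⟦ X ⟧ ÷ₙ (2 ℕ.* suc D ∸ 1 ∸ k)) - avgDeg G * avgDeg G ∎
      where
      open ≡-Reasoning
      X = 2 ℕ.* edges G ℕ.+ D ℕ.* (D ∸ k)

  CS-extremal : ∀ {D δ k} {G : Graph (suc D)} → Irregular G → IsMinDegree G δ → G ≅ CS (suc D) k →
    (δ ≡ k)
    × (2 ℕ.* edges G ≡ (2 ℕ.* suc D ∸ 1) ℕ.* δ ∸ δ ℕ.* δ)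
    × (Var G ≡ avgDeg G * (⟦ 2 ℕ.* edges G ℕ.+ D ℕ.* (D ∸ δ) ⟧ ÷ₙ (2 ℕ.* suc D ∸ 1 ∸ δ)) - avgDeg G * avgDeg G)
  CS-extremal {D} {δ} {k} {G} irregular minDegree G≅CS =
    δ≡k ,
    subst (λ δ → 2 ℕ.* edges G ≡ (2 ℕ.* suc D ∸ 1) ℕ.* δ ∸ δ ℕ.* δ) (sym δ≡k) (edges-CS {G = G} G≅CS k≤D) ,
    subst (λ δ → Var G ≡ avgDeg G * (⟦ 2 ℕ.* edges G ℕ.+ D ℕ.* (D ∸ δ) ⟧ ÷ₙ (2 ℕ.* suc D ∸ 1 ∸ δ)) - avgDeg G * avgDeg G)
          (sym δ≡k) (Var-CS G G≅CS k≤D)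
    where
    k<D : k ℕ.< D
    k<D = CS-irregular⇒k<D {G = G} G≅CS irregular

    k≤D : k ℕ.≤ D
    k≤D = ℕ.<⇒≤ k<D

    δ≡k : δ ≡ k
    δ≡k = minDegree-CS {G = G} G≅CS k<D minDegree

open import Data.Nat using (_∸_)
open import Data.Rational using (ℚ; _*_; _-_; _≤_)
open import Data.Product using (_×_; _,_)
open Variance using (Var≡M₁/n-avgDeg²; Var-bound; CS-extremal)

proposition11 : (n : ℕ) (G : Graph n) (δ : ℕ) → Dominating G → IsMinDegree G δ →
    (Var G ≡ (⟦ M₁ G ⟧ ÷ₙ n) - avgDeg G * avgDeg G)
    × (Var G ≤ avgDeg G * (⟦ 2 Data.Nat.* edges G Data.Nat.+ (n ∸ 1) Data.Nat.* (n ∸ 1 ∸ δ) ⟧ ÷ₙ (2 Data.Nat.* n ∸ 1 ∸ δ)) - avgDeg G * avgDeg G)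
    × ((k : ℕ) → G ≅ CS n k →
        (δ ≡ k)
        × (2 Data.Nat.* edges G ≡ (2 Data.Nat.* n ∸ 1) Data.Nat.* δ ∸ δ Data.Nat.* δ)
        × (Var G ≡ avgDeg G * (⟦ 2 Data.Nat.* edges G Data.Nat.+ (n ∸ 1) Data.Nat.* (n ∸ 1 ∸ δ) ⟧ ÷ₙ (2 Data.Nat.* n ∸ 1 ∸ δ)) - avgDeg G * avgDeg G))
proposition11 zero    G δ (_ , _ , () , _) _
proposition11 (suc D) G δ (_ , irregular , _) minDegree@(_ , δ≤d) =
  Var≡M₁/n-avgDeg² G , Var-bound G δ≤d , λ k → CS-extremal {G = G} irregular minDegree
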